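{- Let $\mathcal I=\mathcal I_{\rho,\iota,\pi}$ be a Grassmannlike necklace with underlying permutation $\mu=\rho^{ -1}\iota$. Then $\mathcal I=\rho(\vec{\mathcal I}_\mu)=\iota(\overleftarrow{\mathcal I}_\mu)$ (applying the permutation to each term). In particular, $\mathcal I$ is of type $(k,n)$ if and only if $\vec{\mathcal I}_\mu$ (equivalently $\mu$) is of type $(k,n)$.
   Context: Indices mod $n$. A Grassmannlike necklace is an $n$-tuple $(I_1,\dots,I_n)$ of subsets of $[n]$ of a common size $k$ (its type is $(k,n)$) with permutations $\rho$ (removal) and $\iota$ (insertion) such that $\rho(a)\in I_a$ and $I_{a+1}=(I_a\setminus\{\rho(a)\})\cup\{\iota(a)\}$; its trip permutation is $\pi=\iota\rho^{ -1}$, denoted $\mathcal I_{\rho,\iota,\pi}$. A permutation $\mu$ has type $(k,n)$ if $\#\{a:a\le\mu^{ -1}(a)\}=k$. For any $\mu\in S_n$, the forward Grassmann necklace $\vec{\mathcal I}_\mu$ is given by $\vec I_1=\{a:a\le\mu^{ -1}(a)\}$, $\vec I_{a+1}=(\vec I_a\setminus\{a\})\cup\{\mu(a)\}$, and the reverse Grassmann necklace $\overleftarrow{\mathcal I}_\mu$ by $\overleftarrow I_1=\{a:\mu(a)\le a\}$, $\overleftarrow I_{a+1}=(\overleftarrow I_a\setminus\{\mu^{ -1}(a)\})\cup\{a\}$. For $\sigma\in S_n$, $\sigma(I_1,\dots,I_n)=(\sigma(I_1),\dots,\sigma(I_n))$. -}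

module Defs where

open import Data.Nat using (ℕ; zero; suc; NonZero)
open import Data.Nat.DivMod using (_%_; m%n<n)
open import Data.Fin using (Fin; toℕ; fromℕ<; _≤?_)
open import Data.Fin.Subset using (Subset; _∈_; _∪_; _-_; ⁅_⁆; ∣_∣)
open import Data.Fin.Permutation using (Permutation′; _⟨$⟩ʳ_; _⟨$⟩ˡ_; flip; _∘ₚ_)
open import Data.Vec using (tabulate; lookup)
open import Data.Bool using (Bool)
open import Relation.Binary.PropositionalEquality using (_≡_)
open import Relation.Nullary.Decidable using (does)

-- Elements of [n] = {1,…,n} are modelled by Fin n = {0,…,n-1} (order-preserving shift by one).
-- Indices of a necklace are taken mod n: the j-th index (j : ℕ, starting from 0 ↔ the paper's 1)
-- is the element j mod n.
finMod : ∀ {n} .{{_ : NonZero n}} → ℕ → Fin n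
finMod {n} j = fromℕ< (m%n<n j n)

sucMod : ∀ {n} .{{_ : NonZero n}} → Fin n → Fin n
sucMod a = finMod (suc (toℕ a))

image : ∀ {n} → Permutation′ n → Subset n → Subset n
image σ S = tabulate (λ y → lookup S (σ ⟨$⟩ˡ y))

Necklace : ℕ → Set
Necklace n = Fin n → Subset n

applyN : ∀ {n} → Permutation′ n → Necklace n → Necklace n
applyN σ I a = image σ (I a)

HasType : ∀ {n} → ℕ → Necklace n → Set
HasType k I = ∀ a → ∣ I a ∣ ≡ k

record IsGrassmannlike {n} .{{_ : NonZero n}} (k : ℕ) (I : Necklace n)
                       (ρ ι : Permutation′ n) : Set where
  field
    size    : HasType k I
    removal : ∀ a → (ρ ⟨$⟩ʳ a) ∈ I a
    step    : ∀ a → I (sucMod a) ≡ ((I a - (ρ ⟨$⟩ʳ a)) ∪ ⁅ ι ⟨$⟩ʳ a ⁆)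

-- underlying permutation μ = ρ⁻¹ ι  (first ι, then ρ⁻¹; stdlib's π₁ ∘ₚ π₂ applies π₁ first)
underlying : ∀ {n} → Permutation′ n → Permutation′ n → Permutation′ n
underlying ρ ι = ι ∘ₚ flip ρ

trip : ∀ {n} → Permutation′ n → Permutation′ n → Permutation′ n
trip ρ ι = flip ρ ∘ₚ ι

fwdStart : ∀ {n} → Permutation′ n → Subset n
fwdStart μ = tabulate (λ a → does (a ≤? (μ ⟨$⟩ˡ a)))

fwdAux : ∀ {n} .{{_ : NonZero n}} → Permutation′ n → ℕ → Subset n
fwdAux μ zero    = fwdStart μ
fwdAux μ (suc j) = (fwdAux μ j - finMod j) ∪ ⁅ μ ⟨$⟩ʳ finMod j ⁆

forwardNecklace : ∀ {n} .{{_ : NonZero n}} → Permutation′ n → Necklace n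
forwardNecklace μ a = fwdAux μ (toℕ a)

revStart : ∀ {n} → Permutation′ n → Subset n
revStart μ = tabulate (λ a → does ((μ ⟨$⟩ʳ a) ≤? a))

revAux : ∀ {n} .{{_ : NonZero n}} → Permutation′ n → ℕ → Subset n
revAux μ zero    = revStart μ
revAux μ (suc j) = (revAux μ j - (μ ⟨$⟩ˡ finMod j)) ∪ ⁅ finMod j ⁆

reverseNecklace : ∀ {n} .{{_ : NonZero n}} → Permutation′ n → Necklace n
reverseNecklace μ a = revAux μ (toℕ a)

PermHasType : ∀ {n} → ℕ → Permutation′ n → Set
PermHasType k μ = ∣ fwdStart μ ∣ ≡ k

-- Follow a single element y through the necklace. By the exchange rule, y leaves at step ρ⁻¹(y),
-- enters at step ι⁻¹(y), and is untouched at every other step; reading the steps cyclically,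
-- y ∈ I₁ iff its last event before wrapping around is an insertion, i.e. iff ρ⁻¹(y) ≤ ι⁻¹(y).
-- With a = ρ⁻¹(y) we have ι⁻¹(y) = μ⁻¹(a), so this says I₁ = ρ(I⃗₁); symmetrically I₁ = ι(I⃖₁).
-- The exchange rule commutes with applying a permutation, and the removals and insertions of
-- ρ(I⃗_μ) and ι(I⃖_μ) are exactly ρ and ι, so the equalities propagate to every term.
-- Applying a permutation preserves sizes, which gives the statement about types.
module Submission where

open import Defs
open import Data.Nat using (ℕ; NonZero)
open import Data.Fin.Subset using (Subset)
open import Data.Fin.Permutation using (Permutation′)
open import Data.Product using (_×_)
open import Function.Bundles using (_⇔_)
open import Relation.Binary.PropositionalEquality using (_≡_)

import Data.Nat.Properties as ℕ
open import Algebra.Properties.CommutativeMonoid.Sum ℕ.+-0-commutativeMonoid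
  using (sum; sum-cong-≗; sum-permute)
open import Data.Bool using (Bool; true; false; _∨_; if_then_else_)
open import Data.Bool.Properties using (∨-zeroʳ; ∨-identityʳ)
open import Data.Fin as Fin using (Fin; toℕ; _≟_)
open import Data.Fin.Permutation using (_⟨$⟩ʳ_; _⟨$⟩ˡ_; flip; inverseˡ; inverseʳ)
open import Data.Fin.Properties using (toℕ-fromℕ<; toℕ-injective; fromℕ<-cong; toℕ<n; <⇒≢)
open import Data.Fin.Subset using (_∪_; _─_; _-_; ⁅_⁆; ∣_∣)
open import Data.Nat using (zero; suc; _+_; _∸_; _<_; _≤_; >-nonZero⁻¹)
open import Data.Nat.DivMod using (_%_; m%n<n; m<n⇒m%n≡m; n%n≡0; m%n%n≡m%n; %-distribˡ-+)
open import Data.Nat.Properties using (m∸n+n≡m; m≤n+m; <⇒≤; ≤-<-trans; <-trans; ≰⇒>; ≤-reflexive)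
open import Data.Product using (_,_)
open import Data.Vec using ([]; _∷_; lookup; tabulate; zipWith)
open import Data.Vec.Properties using (lookup-zipWith; lookup∘tabulate; tabulate∘lookup; tabulate-cong; lookup-replicate)
open import Function using (_∘_)
open import Function.Bundles using (mk⇔)
open import Relation.Binary.PropositionalEquality using (_≢_; refl; sym; trans; cong; cong₂; subst; module ≡-Reasoning)
open import Relation.Nullary.Decidable using (Dec; does; yes; no; dec-true; dec-false; does-⇔)

open ≡-Reasoning

private
  variable
    n : ℕ

lookup-ext : {p q : Subset n} → (∀ y → lookup p y ≡ lookup q y) → p ≡ q
lookup-ext {p = p} {q} h = begin
  p                    ≡⟨ tabulate∘lookup p ⟨
  tabulate (lookup p)  ≡⟨ tabulate-cong h ⟩
  tabulate (lookup q)  ≡⟨ tabulate∘lookup q ⟩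
  q                    ∎

lookup-∪ : (p q : Subset n) (y : Fin n) → lookup (p ∪ q) y ≡ (lookup p y ∨ lookup q y)
lookup-∪ p q y = lookup-zipWith _∨_ y p q

lookup-⁅⁆ : (x y : Fin n) → lookup ⁅ x ⁆ y ≡ does (x ≟ y)
lookup-⁅⁆ Fin.zero    Fin.zero    = refl
lookup-⁅⁆ Fin.zero    (Fin.suc y) = lookup-replicate y false
lookup-⁅⁆ (Fin.suc x) Fin.zero    = refl
lookup-⁅⁆ (Fin.suc x) (Fin.suc y) = lookup-⁅⁆ x y

lookup-─-true : (p q : Subset n) (y : Fin n) → lookup q y ≡ true → lookup (p ─ q) y ≡ false
lookup-─-true (_ ∷ p) (true  ∷ q) Fin.zero    _ = refl
lookup-─-true (_ ∷ p) (_     ∷ q) (Fin.suc y) e = lookup-─-true p q y e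

lookup-─-false : (p q : Subset n) (y : Fin n) → lookup q y ≡ false → lookup (p ─ q) y ≡ lookup p y
lookup-─-false (_ ∷ p) (false ∷ q) Fin.zero    _ = refl
lookup-─-false (_ ∷ p) (_     ∷ q) (Fin.suc y) e = lookup-─-false p q y e

card≡sum : (S : Subset n) → ∣ S ∣ ≡ sum (λ i → if lookup S i then 1 else 0)
card≡sum []          = refl
card≡sum (true  ∷ S) = cong suc (card≡sum S)
card≡sum (false ∷ S) = card≡sum S

exchange : Subset n → Fin n → Fin n → Subset n
exchange S r i = (S - r) ∪ ⁅ i ⁆

lookup-exchange-inserted : (S : Subset n) (r i y : Fin n) → i ≡ y → lookup (exchange S r i) y ≡ true
lookup-exchange-inserted S r i y i≡y = begin
  lookup (exchange S r i) y              ≡⟨ lookup-∪ (S - r) ⁅ i ⁆ y ⟩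
  lookup (S - r) y ∨ lookup ⁅ i ⁆ y      ≡⟨ cong (lookup (S - r) y ∨_) (trans (lookup-⁅⁆ i y) (dec-true (i ≟ y) i≡y)) ⟩
  lookup (S - r) y ∨ true                ≡⟨ ∨-zeroʳ _ ⟩
  true                                   ∎

lookup-exchange-not-inserted : (S : Subset n) (r i y : Fin n) → i ≢ y →
                               lookup (exchange S r i) y ≡ lookup (S - r) y
lookup-exchange-not-inserted S r i y i≢y = begin
  lookup (exchange S r i) y              ≡⟨ lookup-∪ (S - r) ⁅ i ⁆ y ⟩
  lookup (S - r) y ∨ lookup ⁅ i ⁆ y      ≡⟨ cong (lookup (S - r) y ∨_) (trans (lookup-⁅⁆ i y) (dec-false (i ≟ y) i≢y)) ⟩
  lookup (S - r) y ∨ false               ≡⟨ ∨-identityʳ _ ⟩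
  lookup (S - r) y                       ∎

lookup-exchange-removed : (S : Subset n) (r i y : Fin n) → r ≡ y → i ≢ y → lookup (exchange S r i) y ≡ false
lookup-exchange-removed S r i y r≡y i≢y =
  trans (lookup-exchange-not-inserted S r i y i≢y)
        (lookup-─-true S ⁅ r ⁆ y (trans (lookup-⁅⁆ r y) (dec-true (r ≟ y) r≡y)))

lookup-exchange-other : (S : Subset n) (r i y : Fin n) → r ≢ y → i ≢ y →
                        lookup (exchange S r i) y ≡ lookup S y
lookup-exchange-other S r i y r≢y i≢y =
  trans (lookup-exchange-not-inserted S r i y i≢y)
        (lookup-─-false S ⁅ r ⁆ y (trans (lookup-⁅⁆ r y) (dec-false (r ≟ y) r≢y)))

⟨$⟩ʳ≡⇒≡⟨$⟩ˡ : (σ : Permutation′ n) {a y : Fin n} → σ ⟨$⟩ʳ a ≡ y → a ≡ σ ⟨$⟩ˡ y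
⟨$⟩ʳ≡⇒≡⟨$⟩ˡ σ e = trans (sym (inverseˡ σ)) (cong (σ ⟨$⟩ˡ_) e)

≡⟨$⟩ˡ⇒⟨$⟩ʳ≡ : (σ : Permutation′ n) {a y : Fin n} → a ≡ σ ⟨$⟩ˡ y → σ ⟨$⟩ʳ a ≡ y
≡⟨$⟩ˡ⇒⟨$⟩ʳ≡ σ e = trans (cong (σ ⟨$⟩ʳ_) e) (inverseʳ σ)

lookup-image : (σ : Permutation′ n) (S : Subset n) (y : Fin n) → lookup (image σ S) y ≡ lookup S (σ ⟨$⟩ˡ y)
lookup-image σ S = lookup∘tabulate (λ y → lookup S (σ ⟨$⟩ˡ y))

image-zipWith : (σ : Permutation′ n) (f : Bool → Bool → Bool) (p q : Subset n) →
                image σ (zipWith f p q) ≡ zipWith f (image σ p) (image σ q)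
image-zipWith σ f p q = lookup-ext λ y → begin
  lookup (image σ (zipWith f p q)) y                      ≡⟨ lookup-image σ (zipWith f p q) y ⟩
  lookup (zipWith f p q) (σ ⟨$⟩ˡ y)                       ≡⟨ lookup-zipWith f (σ ⟨$⟩ˡ y) p q ⟩
  f (lookup p (σ ⟨$⟩ˡ y)) (lookup q (σ ⟨$⟩ˡ y))           ≡⟨ cong₂ f (lookup-image σ p y) (lookup-image σ q y) ⟨
  f (lookup (image σ p) y) (lookup (image σ q) y)         ≡⟨ lookup-zipWith f y (image σ p) (image σ q) ⟨
  lookup (zipWith f (image σ p) (image σ q)) y            ∎

image-⁅⁆ : (σ : Permutation′ n) (x : Fin n) → image σ ⁅ x ⁆ ≡ ⁅ σ ⟨$⟩ʳ x ⁆
image-⁅⁆ σ x = lookup-ext λ y → begin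
  lookup (image σ ⁅ x ⁆) y   ≡⟨ lookup-image σ ⁅ x ⁆ y ⟩
  lookup ⁅ x ⁆ (σ ⟨$⟩ˡ y)    ≡⟨ lookup-⁅⁆ x (σ ⟨$⟩ˡ y) ⟩
  does (x ≟ σ ⟨$⟩ˡ y)        ≡⟨ does-⇔ (mk⇔ (≡⟨$⟩ˡ⇒⟨$⟩ʳ≡ σ) (⟨$⟩ʳ≡⇒≡⟨$⟩ˡ σ)) (x ≟ σ ⟨$⟩ˡ y) (σ ⟨$⟩ʳ x ≟ y) ⟩
  does (σ ⟨$⟩ʳ x ≟ y)        ≡⟨ lookup-⁅⁆ (σ ⟨$⟩ʳ x) y ⟨
  lookup ⁅ σ ⟨$⟩ʳ x ⁆ y      ∎

image-exchange : (σ : Permutation′ n) (S : Subset n) (r i : Fin n) →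
                 image σ (exchange S r i) ≡ exchange (image σ S) (σ ⟨$⟩ʳ r) (σ ⟨$⟩ʳ i)
image-exchange σ S r i = begin
  image σ ((S ─ ⁅ r ⁆) ∪ ⁅ i ⁆)                          ≡⟨ image-zipWith σ _ (S ─ ⁅ r ⁆) ⁅ i ⁆ ⟩
  image σ (S ─ ⁅ r ⁆) ∪ image σ ⁅ i ⁆                    ≡⟨ cong₂ _∪_ (image-zipWith σ _ S ⁅ r ⁆) (image-⁅⁆ σ i) ⟩
  (image σ S ─ image σ ⁅ r ⁆) ∪ ⁅ σ ⟨$⟩ʳ i ⁆             ≡⟨ cong (λ R → (image σ S ─ R) ∪ ⁅ σ ⟨$⟩ʳ i ⁆) (image-⁅⁆ σ r) ⟩
  (image σ S ─ ⁅ σ ⟨$⟩ʳ r ⁆) ∪ ⁅ σ ⟨$⟩ʳ i ⁆             ∎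

∣image∣ : (σ : Permutation′ n) (S : Subset n) → ∣ image σ S ∣ ≡ ∣ S ∣
∣image∣ σ S = begin
  ∣ image σ S ∣                                               ≡⟨ card≡sum (image σ S) ⟩
  sum (λ y → indicator (lookup (image σ S) y))                ≡⟨ sum-cong-≗ (cong indicator ∘ lookup-image σ S) ⟩
  sum (λ y → indicator (lookup S (σ ⟨$⟩ˡ y)))                 ≡⟨ sum-permute (indicator ∘ lookup S) (flip σ) ⟨
  sum (λ i → indicator (lookup S i))                          ≡⟨ card≡sum S ⟨
  ∣ S ∣                                                       ∎
  where
  indicator : Bool → ℕ
  indicator b = if b then 1 else 0

module _ {n : ℕ} .{{_ : NonZero n}} where

  finMod-cong : {i j : ℕ} → i % n ≡ j % n → finMod {n} i ≡ finMod j
  finMod-cong {i} {j} e = fromℕ<-cong (i % n) (j % n) e (m%n<n i n) (m%n<n j n)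

  toℕ-finMod : {j : ℕ} → j < n → toℕ (finMod {n} j) ≡ j
  toℕ-finMod {j} j<n = trans (toℕ-fromℕ< (m%n<n j n)) (m<n⇒m%n≡m j<n)

  finMod-toℕ : (a : Fin n) → finMod (toℕ a) ≡ a
  finMod-toℕ a = toℕ-injective (toℕ-finMod (toℕ<n a))

  finMod-n : finMod {n} n ≡ finMod 0
  finMod-n = finMod-cong (trans (n%n≡0 n) (sym (m<n⇒m%n≡m (>-nonZero⁻¹ n))))

  finMod-suc : (j : ℕ) → finMod {n} (suc j) ≡ sucMod (finMod j)
  finMod-suc j = trans (finMod-cong suc-%) (cong (finMod ∘ suc) (sym (toℕ-fromℕ< (m%n<n j n))))
    where
    suc-% : suc j % n ≡ suc (j % n) % n
    suc-% = begin
      (1 + j) % n                 ≡⟨ %-distribˡ-+ 1 j n ⟩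
      (1 % n + j % n) % n         ≡⟨ cong (λ t → (1 % n + t) % n) (m%n%n≡m%n j n) ⟨
      (1 % n + j % n % n) % n     ≡⟨ %-distribˡ-+ 1 (j % n) n ⟨
      (1 + j % n) % n             ∎

  steady-until-wrap : {A : Set} (f : Fin n → A) (x : Fin n) →
                      (∀ a → x Fin.< a → f (sucMod a) ≡ f a) → f (finMod 0) ≡ f (sucMod x)
  steady-until-wrap f x steady = begin
    f (finMod 0)                        ≡⟨ cong f finMod-n ⟨
    f (finMod n)                        ≡⟨ cong (f ∘ finMod) (m∸n+n≡m (toℕ<n x)) ⟨
    f (finMod (n ∸ suc t + suc t))      ≡⟨ from-after (n ∸ suc t) (≤-reflexive (m∸n+n≡m (toℕ<n x))) ⟩
    f (sucMod x)                        ∎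
    where
    t : ℕ
    t = toℕ x

    from-after : ∀ d → d + suc t ≤ n → f (finMod (d + suc t)) ≡ f (sucMod x)
    from-after zero    _  = refl
    from-after (suc d) lt = begin
      f (finMod (suc (d + suc t)))      ≡⟨ cong f (finMod-suc (d + suc t)) ⟩
      f (sucMod (finMod (d + suc t)))   ≡⟨ steady (finMod (d + suc t)) x<j ⟩
      f (finMod (d + suc t))            ≡⟨ from-after d (<⇒≤ lt) ⟩
      f (sucMod x)                      ∎
      where
      x<j : x Fin.< finMod (d + suc t)
      x<j = subst (t <_) (sym (toℕ-finMod lt)) (m≤n+m (suc t) d)

module _ {n : ℕ} .{{_ : NonZero n}} {k : ℕ} {I : Necklace n} {ρ ι : Permutation′ n}
         (G : IsGrassmannlike k I ρ ι) where
  open IsGrassmannlike G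

  private
    μ : Permutation′ n
    μ = underlying ρ ι

  step-finMod : (j : ℕ) → I (finMod (suc j)) ≡ exchange (I (finMod j)) (ρ ⟨$⟩ʳ finMod j) (ι ⟨$⟩ʳ finMod j)
  step-finMod j = trans (cong I (finMod-suc j)) (step (finMod j))

  lookup-after-insertion : (y : Fin n) → lookup (I (sucMod (ι ⟨$⟩ˡ y))) y ≡ true
  lookup-after-insertion y = trans (cong (λ S → lookup S y) (step c))
    (lookup-exchange-inserted (I c) (ρ ⟨$⟩ʳ c) (ι ⟨$⟩ʳ c) y (inverseʳ ι))
    where
    c : Fin n
    c = ι ⟨$⟩ˡ y

  lookup-after-removal : (y : Fin n) → ρ ⟨$⟩ˡ y ≢ ι ⟨$⟩ˡ y → lookup (I (sucMod (ρ ⟨$⟩ˡ y))) y ≡ false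
  lookup-after-removal y b≢c = trans (cong (λ S → lookup S y) (step b))
    (lookup-exchange-removed (I b) (ρ ⟨$⟩ʳ b) (ι ⟨$⟩ʳ b) y (inverseʳ ρ) (b≢c ∘ ⟨$⟩ʳ≡⇒≡⟨$⟩ˡ ι))
    where
    b : Fin n
    b = ρ ⟨$⟩ˡ y

  lookup-unchanged : (y a : Fin n) → a ≢ ρ ⟨$⟩ˡ y → a ≢ ι ⟨$⟩ˡ y → lookup (I (sucMod a)) y ≡ lookup (I a) y
  lookup-unchanged y a a≢b a≢c = trans (cong (λ S → lookup S y) (step a))
    (lookup-exchange-other (I a) (ρ ⟨$⟩ʳ a) (ι ⟨$⟩ʳ a) y (a≢b ∘ ⟨$⟩ʳ≡⇒≡⟨$⟩ˡ ρ) (a≢c ∘ ⟨$⟩ʳ≡⇒≡⟨$⟩ˡ ι))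

  lookup-first : (y : Fin n) → lookup (I (finMod 0)) y ≡ does (ρ ⟨$⟩ˡ y Fin.≤? ι ⟨$⟩ˡ y)
  lookup-first y = by-order (b Fin.≤? c)
    where
    b c : Fin n
    b = ρ ⟨$⟩ˡ y
    c = ι ⟨$⟩ˡ y

    f : Fin n → Bool
    f a = lookup (I a) y

    by-order : (b≤c? : Dec (b Fin.≤ c)) → f (finMod 0) ≡ does b≤c?
    by-order (yes b≤c) = trans (steady-until-wrap f c λ a c<a →
                                 lookup-unchanged y a (λ a≡b → <⇒≢ (≤-<-trans b≤c c<a) (sym a≡b))
                                                      (λ a≡c → <⇒≢ c<a (sym a≡c)))
                               (lookup-after-insertion y)
    by-order (no b≰c)  = trans (steady-until-wrap f b λ a b<a →
                                 lookup-unchanged y a (λ a≡b → <⇒≢ b<a (sym a≡b))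
                                                      (λ a≡c → <⇒≢ (<-trans (≰⇒> b≰c) b<a) (sym a≡c)))
                               (lookup-after-removal y (λ b≡c → b≰c (≤-reflexive (cong toℕ b≡c))))

  first≡image-fwdStart : I (finMod 0) ≡ image ρ (fwdStart μ)
  first≡image-fwdStart = lookup-ext λ y → begin
    lookup (I (finMod 0)) y                          ≡⟨ lookup-first y ⟩
    does (ρ ⟨$⟩ˡ y Fin.≤? ι ⟨$⟩ˡ y)                  ≡⟨ cong (λ z → does (ρ ⟨$⟩ˡ y Fin.≤? ι ⟨$⟩ˡ z)) (inverseʳ ρ) ⟨
    does (ρ ⟨$⟩ˡ y Fin.≤? μ ⟨$⟩ˡ (ρ ⟨$⟩ˡ y))         ≡⟨ lookup∘tabulate _ (ρ ⟨$⟩ˡ y) ⟨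
    lookup (fwdStart μ) (ρ ⟨$⟩ˡ y)                   ≡⟨ lookup-image ρ (fwdStart μ) y ⟨
    lookup (image ρ (fwdStart μ)) y                  ∎

  first≡image-revStart : I (finMod 0) ≡ image ι (revStart μ)
  first≡image-revStart = lookup-ext λ y → begin
    lookup (I (finMod 0)) y                          ≡⟨ lookup-first y ⟩
    does (ρ ⟨$⟩ˡ y Fin.≤? ι ⟨$⟩ˡ y)                  ≡⟨ cong (λ z → does (ρ ⟨$⟩ˡ z Fin.≤? ι ⟨$⟩ˡ y)) (inverseʳ ι) ⟨
    does (μ ⟨$⟩ʳ (ι ⟨$⟩ˡ y) Fin.≤? ι ⟨$⟩ˡ y)         ≡⟨ lookup∘tabulate _ (ι ⟨$⟩ˡ y) ⟨
    lookup (revStart μ) (ι ⟨$⟩ˡ y)                   ≡⟨ lookup-image ι (revStart μ) y ⟨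
    lookup (image ι (revStart μ)) y                  ∎

  image-sequence : (σ : Permutation′ n) (J : ℕ → Subset n) (r i : ℕ → Fin n) →
                   (∀ j → J (suc j) ≡ exchange (J j) (r j) (i j)) →
                   (∀ j → σ ⟨$⟩ʳ r j ≡ ρ ⟨$⟩ʳ finMod j) → (∀ j → σ ⟨$⟩ʳ i j ≡ ι ⟨$⟩ʳ finMod j) →
                   I (finMod 0) ≡ image σ (J 0) → ∀ j → I (finMod j) ≡ image σ (J j)
  image-sequence σ J r i J-step σr σi first zero    = first
  image-sequence σ J r i J-step σr σi first (suc j) = begin
    I (finMod (suc j))                                             ≡⟨ step-finMod j ⟩
    exchange (I (finMod j)) (ρ ⟨$⟩ʳ finMod j) (ι ⟨$⟩ʳ finMod j)    ≡⟨ cong (λ S → exchange S _ _) (image-sequence σ J r i J-step σr σi first j) ⟩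
    exchange (image σ (J j)) (ρ ⟨$⟩ʳ finMod j) (ι ⟨$⟩ʳ finMod j)   ≡⟨ cong₂ (exchange (image σ (J j))) (σr j) (σi j) ⟨
    exchange (image σ (J j)) (σ ⟨$⟩ʳ r j) (σ ⟨$⟩ʳ i j)             ≡⟨ image-exchange σ (J j) (r j) (i j) ⟨
    image σ (exchange (J j) (r j) (i j))                           ≡⟨ cong (image σ) (J-step j) ⟨
    image σ (J (suc j))                                            ∎

  ≡applyN-forward : ∀ a → I a ≡ applyN ρ (forwardNecklace μ) a
  ≡applyN-forward a = trans (cong I (sym (finMod-toℕ a)))
    (image-sequence ρ (fwdAux μ) finMod (λ j → μ ⟨$⟩ʳ finMod j)
                    (λ _ → refl) (λ _ → refl) (λ _ → inverseʳ ρ) first≡image-fwdStart (toℕ a))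

  ≡applyN-reverse : ∀ a → I a ≡ applyN ι (reverseNecklace μ) a
  ≡applyN-reverse a = trans (cong I (sym (finMod-toℕ a)))
    (image-sequence ι (revAux μ) (λ j → μ ⟨$⟩ˡ finMod j) finMod
                    (λ _ → refl) (λ _ → inverseʳ ι) (λ _ → refl) first≡image-revStart (toℕ a))

  ∣I∣≡∣forward∣ : ∀ a → ∣ I a ∣ ≡ ∣ forwardNecklace μ a ∣
  ∣I∣≡∣forward∣ a = trans (cong ∣_∣ (≡applyN-forward a)) (∣image∣ ρ (forwardNecklace μ a))

  ∣I-first∣≡∣fwdStart∣ : ∣ I (finMod 0) ∣ ≡ ∣ fwdStart μ ∣
  ∣I-first∣≡∣fwdStart∣ = trans (cong ∣_∣ first≡image-fwdStart) (∣image∣ ρ (fwdStart μ))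

  type-forward : (k′ : ℕ) → HasType k′ I ⇔ HasType k′ (forwardNecklace μ)
  type-forward k′ = mk⇔ (λ h a → trans (sym (∣I∣≡∣forward∣ a)) (h a))
                        (λ h a → trans (∣I∣≡∣forward∣ a) (h a))

  type-underlying : (k′ : ℕ) → HasType k′ (forwardNecklace μ) ⇔ PermHasType k′ μ
  type-underlying k′ = mk⇔ to from
    where
    to : HasType k′ (forwardNecklace μ) → PermHasType k′ μ
    to h = begin
      ∣ fwdStart μ ∣                      ≡⟨ ∣I-first∣≡∣fwdStart∣ ⟨
      ∣ I (finMod 0) ∣                    ≡⟨ ∣I∣≡∣forward∣ (finMod 0) ⟩
      ∣ forwardNecklace μ (finMod 0) ∣    ≡⟨ h (finMod 0) ⟩
      k′                                  ∎

    from : PermHasType k′ μ → HasType k′ (forwardNecklace μ)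
    from p a = begin
      ∣ forwardNecklace μ a ∣             ≡⟨ ∣I∣≡∣forward∣ a ⟨
      ∣ I a ∣                             ≡⟨ size a ⟩
      k                                   ≡⟨ size (finMod 0) ⟨
      ∣ I (finMod 0) ∣                    ≡⟨ ∣I-first∣≡∣fwdStart∣ ⟩
      ∣ fwdStart μ ∣                      ≡⟨ p ⟩
      k′                                  ∎

lemma3p11 : (n : ℕ) .{{_ : NonZero n}} (k : ℕ) (I : Necklace n) (ρ ι : Permutation′ n) →
            IsGrassmannlike k I ρ ι →
            (∀ a → I a ≡ applyN ρ (forwardNecklace (underlying ρ ι)) a)
            × (∀ a → I a ≡ applyN ι (reverseNecklace (underlying ρ ι)) a)
            × (∀ (k′ : ℕ) → (HasType k′ I ⇔ HasType k′ (forwardNecklace (underlying ρ ι)))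
                            × (HasType k′ (forwardNecklace (underlying ρ ι)) ⇔ PermHasType k′ (underlying ρ ι)))
lemma3p11 n k I ρ ι G = ≡applyN-forward G , ≡applyN-reverse G , λ k′ → type-forward G k′ , type-underlying G k′
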